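{- Let $N$ be a finite index set, let $S, T \subseteq N$ and let $P \subseteq [0,1]^S \times \mathbb{R}^{N \setminus S}$ be a rational polyhedron. Then the following are equivalent: (a) $x_T$ is implied integer by $x_S$ for $P$, i.e., $\mathrm{conv}(P \cap \mathcal{M}^S) = \mathrm{conv}(P \cap \mathcal{M}^{S\cup T})$. (b) For each $\bar{x} \in \{0,1\}^S$, every minimal face of $Q_S(\bar{x})$ contains a point in $\mathcal{M}^T$. (c) For each $\bar{x} \in \{0,1\}^S$, $Q_S(\bar{x})$ is $T$-integral.
   Context: For $S \subseteq N$, $\mathcal{M}^S \coloneqq \{ x \in \mathbb{R}^N \mid x_i \in \mathbb{Z} \ \forall i \in S \}$. For $\bar{x} \in \mathbb{Z}^S$, the fiber is $Q_S(\bar{x}) \coloneqq \{ x \in P \mid x_S = \bar{x} \}$. A rational polyhedron $Q \subseteq \mathbb{R}^N$ is $T$-integral if $Q = \mathrm{conv}(Q \cap \mathcal{M}^T)$.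
   Formalization: Points are taken in ℚ^N instead of ℝ^N, so P, its fibers, faces and convex hulls consist of rational points, with rational convex weights and rational inequalities defining faces. -}

module Defs where

open import Data.Nat using (ℕ; zero; suc)
open import Data.Integer using (ℤ)
open import Data.Fin using (Fin; zero; suc)
open import Data.Fin.Subset using (Subset; _∈_; _∪_)
open import Data.Bool using (Bool; true; false; if_then_else_)
open import Data.Rational using (ℚ; 0ℚ; 1ℚ; _+_; _*_; _≤_; _/_)
open import Data.Product using (Σ; _×_; ∃; ∃-syntax)
open import Relation.Binary.PropositionalEquality using (_≡_)
open import Level using (Level; _⊔_)

Point : ℕ → Set
Point n = Fin n → ℚ

PSet : ℕ → Set₁
PSet n = Point n → Set

sumFin : (k : ℕ) → (Fin k → ℚ) → ℚ
sumFin zero    f = 0ℚ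
sumFin (suc k) f = f zero + sumFin k (λ i → f (suc i))

_·_ : {n : ℕ} → Point n → Point n → ℚ
_·_ {n} c x = sumFin n (λ i → c i * x i)

record Polyhedron (n : ℕ) : Set where
  field
    m : ℕ
    A : Fin m → Point n
    b : Fin m → ℚ

_∈P_ : {n : ℕ} → Point n → Polyhedron n → Set
x ∈P P = ∀ j → (Polyhedron.A P j · x) ≤ Polyhedron.b P j

⟦_⟧ : {n : ℕ} → Polyhedron n → PSet n
⟦ P ⟧ x = x ∈P P

IsInt : ℚ → Set
IsInt q = ∃[ z ] q ≡ z / 1

𝓜 : {n : ℕ} → Subset n → PSet n
𝓜 S x = ∀ i → i ∈ S → IsInt (x i)

_∩_ : {n : ℕ} → PSet n → PSet n → PSet n
(X ∩ Y) x = X x × Y x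

_≐_ : {n : ℕ} → PSet n → PSet n → Set
X ≐ Y = ∀ x → (X x → Y x) × (Y x → X x)

conv : {n : ℕ} → PSet n → PSet n
conv {n} X x =
  Σ ℕ λ k → Σ (Fin k → Point n) λ p → Σ (Fin k → ℚ) λ w →
    (∀ j → X (p j)) × (∀ j → 0ℚ ≤ w j) × (sumFin k w ≡ 1ℚ) ×
    (∀ i → x i ≡ sumFin k (λ j → w j * p j i))

bit : Bool → ℚ
bit b = if b then 1ℚ else 0ℚ

-- fiber Q_S(x̄) = {x ∈ P | x_S = x̄}; x̄ ∈ {0,1}^S is given by a
-- Boolean vector whose values outside S are irrelevant
Fiber : {n : ℕ} → Polyhedron n → Subset n → (Fin n → Bool) → PSet n
Fiber P S x̄ x = x ∈P P × (∀ i → i ∈ S → x i ≡ bit (x̄ i))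

IsFace : {n : ℕ} → PSet n → PSet n → Set
IsFace {n} Q F =
  Σ (Point n) λ c → Σ ℚ λ δ →
    (∀ x → Q x → (c · x) ≤ δ) × (F ≐ (λ x → Q x × (c · x) ≡ δ))

Nonempty : {n : ℕ} → PSet n → Set
Nonempty {n} X = Σ (Point n) X

IsMinimalFace : {n : ℕ} → PSet n → PSet n → Set₁
IsMinimalFace Q F =
  IsFace Q F × Nonempty F ×
  (∀ G → IsFace Q G → Nonempty G → (∀ x → G x → F x) → ∀ x → F x → G x)

TIntegral : {n : ℕ} → Subset n → PSet n → Set
TIntegral T Q = Q ≐ conv (Q ∩ 𝓜 T)

InUnitCubeOn : {n : ℕ} → Subset n → Polyhedron n → Set
InUnitCubeOn S P = ∀ x → x ∈P P → ∀ i → i ∈ S → (0ℚ ≤ x i) × (x i ≤ 1ℚ)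

-- The core is (b ⇒ c) for an arbitrary rational polyhedron Q = {x | A x ≤ b}: if
-- every minimal face of Q meets 𝓜^T, then Q ⊆ conv (Q ∩ 𝓜^T). Argue by induction on the set of
-- rows tight at x ∈ Q. If some direction d keeps the tight rows tight but changes another row,
-- walk from x along ±d until a further row becomes tight: x is then a convex combination of the
-- two endpoints, or an endpoint plus a recession direction of Q. Otherwise the rows tight at x
-- cut out a minimal face; it contains a point z ∈ 𝓜^T, and x − z is in the lineality space.
-- Recession directions d are harmless because some K ≥ 1 makes K d integral.
-- Each fiber is a polyhedron; a face of a T-integral polyhedron meets 𝓜^T, giving (c ⇒ b), and
-- (a ⇔ c) holds because P ∩ 𝓜^S is covered by the fibers while a convex combination of points of
-- P ∩ 𝓜^(S ∪ T) lying in a fiber uses only points of that fiber, x̄ being a vertex of the cube.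

{-# OPTIONS --safe #-}
module Submission where

open import Defs
open import Data.Bool using (Bool; true; false)
open import Data.Fin using (Fin; zero; suc; splitAt)
open import Data.Fin.Properties using (all?; any?; ¬∀⟶∃¬)
open import Data.Fin.Subset using (Subset; _∈_; _∉_; _∪_; _⊆_; _⊂_; _⊃_)
open import Data.Fin.Subset.Induction using (⊃-wellFounded)
open import Data.Fin.Subset.Properties using (_∈?_; p⊆p∪q; q⊆p∪q; x∈p∪q⁻)
open import Data.Integer as ℤ using (-[1+_]; +≤+)
import Data.Integer.Properties as ℤ
open import Data.List using (filter; allFin)
import Data.List.Extrema
open import Data.List.Membership.Propositional.Properties using (∈-filter⁺; ∈-allFin)
import Data.List.Relation.Unary.All as ListAll
open import Data.List.Relation.Unary.All.Properties using (all-filter)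
open import Data.Nat as ℕ using (ℕ; zero; suc)
open import Data.Nat.Coprimality using (Coprime; 1-coprimeTo) renaming (sym to coprime-sym)
open import Data.Nat.GCD using (gcd-zeroʳ)
open import Data.Product using (Σ; _×_; _,_; proj₁; proj₂; Σ-syntax; ∃)
open import Data.Rational
  using ( ℚ; mkℚ; 0ℚ; 1ℚ; _+_; _*_; -_; _-_; _≤_; _<_; _/_; 1/_; _≟_; _<?_; ↧_; ↧ₙ_
        ; *≤*; ≢-nonZero; positive; nonNegative; nonPositive)
open import Data.Rational.Properties
open import Algebra.Properties.Group +-0-group using (⁻¹-involutive; x∙y⁻¹≈ε⇒x≈y; x≈y⇒x∙y⁻¹≈ε)
open import Data.Rational.Solver using (module +-*-Solver)
import Data.Rational.Unnormalised as ℚᵘ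
import Data.Rational.Unnormalised.Properties as ℚᵘ
open import Data.Sum using (_⊎_; inj₁; inj₂; [_,_]′)
open import Data.Sum.Properties using ([,]-map)
open import Data.Unit using (⊤; tt)
open import Data.Vec using (tabulate)
open import Data.Vec.Functional using (_++_; zipWith)
import Data.Vec.Functional.Relation.Binary.Pointwise.Properties as Pointwise
import Data.Vec.Functional.Relation.Unary.All.Properties as VecAll
open import Data.Vec.Properties using (lookup∘tabulate; lookup⇒[]=; []=⇒lookup)
open import Function using (_∘_; id; _on_)
open import Induction.WellFounded using (Acc; acc)
open import Relation.Binary.Bundles using (DecTotalOrder)
import Relation.Binary.Construct.On as On
open import Relation.Binary.Definitions using (tri<; tri≈; tri>)
open import Relation.Binary.PropositionalEquality
open import Relation.Nullary using (yes; no; does; contradiction)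
open import Relation.Nullary.Decidable using (dec-true)
open import Relation.Unary using (Decidable)
open +-*-Solver using (solve; _:=_; _:+_; _:-_; _:*_; :-_; con)

recip : ℚ → ℚ
recip q with q ≟ 0ℚ
... | yes _   = 0ℚ
... | no q≢0 = 1/_ q {{≢-nonZero q≢0}}

*-recipʳ : ∀ {q} → q ≢ 0ℚ → q * recip q ≡ 1ℚ
*-recipʳ {q} q≢0 with q ≟ 0ℚ
... | yes q≡0  = contradiction q≡0 q≢0
... | no q≢0′ = *-inverseʳ q {{≢-nonZero q≢0′}}

recip-pos : ∀ {q} → 0ℚ < q → 0ℚ < recip q
recip-pos {q} 0<q with q ≟ 0ℚ
... | yes q≡0 = contradiction (sym q≡0) (<⇒≢ 0<q)
... | no _    = positive⁻¹ _ {{1/pos⇒pos q {{positive 0<q}}}}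

*-positive : ∀ {p q} → 0ℚ < p → 0ℚ < q → 0ℚ < p * q
*-positive {p} {q} 0<p 0<q = positive⁻¹ _ {{pos*pos⇒pos p {{positive 0<p}} q {{positive 0<q}}}}

*-nonNegative : ∀ {p q} → 0ℚ ≤ p → 0ℚ ≤ q → 0ℚ ≤ p * q
*-nonNegative {p} {q} 0≤p 0≤q =
  nonNegative⁻¹ _ {{nonNeg*nonNeg⇒nonNeg p {{nonNegative 0≤p}} q {{nonNegative 0≤q}}}}

*-nonPositive : ∀ {p q} → 0ℚ ≤ p → q ≤ 0ℚ → p * q ≤ 0ℚ
*-nonPositive {p} {q} 0≤p q≤0 =
  nonPositive⁻¹ _ {{nonNeg*nonPos⇒nonPos p {{nonNegative 0≤p}} q {{nonPositive q≤0}}}}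

w≡0⇒w*p≡w*q : ∀ {w} p q → w ≡ 0ℚ → w * p ≡ w * q
w≡0⇒w*p≡w*q p q refl = trans (*-zeroˡ p) (sym (*-zeroˡ q))

p+[q-p]*r⁻¹*r≡q : ∀ p q {r} → r ≢ 0ℚ → p + (q - p) * recip r * r ≡ q
p+[q-p]*r⁻¹*r≡q p q {r} r≢0 = begin
  p + (q - p) * recip r * r
    ≡⟨ solve 4 (λ p q s r → p :+ (q :- p) :* s :* r := p :+ (q :- p) :* (r :* s)) refl p q (recip r) r ⟩
  p + (q - p) * (r * recip r) ≡⟨ cong (λ z → p + (q - p) * z) (*-recipʳ r≢0) ⟩
  p + (q - p) * 1ℚ            ≡⟨ solve 2 (λ p q → p :+ (q :- p) :* con 1ℚ := q) refl p q ⟩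
  q                           ∎
  where open ≡-Reasoning

p≤q⇒0≤q-p : ∀ {p q} → p ≤ q → 0ℚ ≤ q - p
p≤q⇒0≤q-p {p} {q} p≤q = subst (_≤ q - p) (+-inverseʳ p) (+-monoˡ-≤ (- p) p≤q)

p<q⇒0<q-p : ∀ {p q} → p < q → 0ℚ < q - p
p<q⇒0<q-p {p} {q} p<q = subst (_< q - p) (+-inverseʳ p) (+-monoˡ-< (- p) p<q)

≤∧≢⇒< : ∀ {p q} → p ≤ q → p ≢ q → p < q
≤∧≢⇒< {p} {q} p≤q p≢q with <-cmp p q
... | tri< p<q _ _ = p<q
... | tri≈ _ p≡q _ = contradiction p≡q p≢q
... | tri> _ _ q<p = contradiction (<-≤-trans q<p p≤q) (<-irrefl refl)

neg-cancel-≤ : ∀ {p q} → - p ≤ - q → q ≤ p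
neg-cancel-≤ {p} {q} -p≤-q = subst₂ _≤_ (⁻¹-involutive q) (⁻¹-involutive p) (neg-antimono-≤ -p≤-q)

+-cancelʳ-≤ : ∀ {p q} r → p + r ≤ q + r → p ≤ q
+-cancelʳ-≤ {p} {q} r p+r≤q+r = subst₂ _≤_ (cancel p) (cancel q) (+-monoˡ-≤ (- r) p+r≤q+r)
  where
  cancel : ∀ x → x + r - r ≡ x
  cancel x = solve 2 (λ x r → x :+ r :- r := x) refl x r

≤-+-≡⇒≡ : ∀ {a b c d} → a ≤ c → b ≤ d → a + b ≡ c + d → a ≡ c
≤-+-≡⇒≡ {a} {b} {c} {d} a≤c b≤d a+b≡c+d =
  ≤-antisym a≤c (+-cancelʳ-≤ d (subst (_≤ a + d) a+b≡c+d (+-monoʳ-≤ a b≤d)))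

*-cancelˡ-≡-pos : ∀ {r p q} → 0ℚ < r → r * p ≡ r * q → p ≡ q
*-cancelˡ-≡-pos {r} 0<r rp≡rq = ≤-antisym
  (*-cancelˡ-≤-pos r {{positive 0<r}} (≤-reflexive rp≡rq))
  (*-cancelˡ-≤-pos r {{positive 0<r}} (≤-reflexive (sym rp≡rq)))

IsInt-mkℚ : ∀ z .(c : Coprime ℤ.∣ z ∣ 1) → IsInt (mkℚ z 0 c)
IsInt-mkℚ z c = z , sym (↥p/↧p≡p (mkℚ z 0 c))

IsInt⇒denominator≡1 : ∀ {q} → IsInt q → ↧ₙ q ≡ 1
IsInt⇒denominator≡1 (z , refl) = ℤ.+-injective (trans (sym (ℤ.*-identityʳ _))
  (subst (λ g → ↧ (z / 1) ℤ.* ℤ.+ g ≡ ℤ.+ 1) (gcd-zeroʳ ℤ.∣ z ∣) (↧-/ z 1)))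

IsInt-+ : ∀ {p q} → IsInt p → IsInt q → IsInt (p + q)
IsInt-+ {mkℚ a _ _} {mkℚ b _ _} p∈ℤ q∈ℤ
  with IsInt⇒denominator≡1 p∈ℤ | IsInt⇒denominator≡1 q∈ℤ
... | refl | refl = a ℤ.* ℤ.+ 1 ℤ.+ b ℤ.* ℤ.+ 1 , refl

IsInt-* : ∀ {p q} → IsInt p → IsInt q → IsInt (p * q)
IsInt-* {mkℚ a _ _} {mkℚ b _ _} p∈ℤ q∈ℤ
  with IsInt⇒denominator≡1 p∈ℤ | IsInt⇒denominator≡1 q∈ℤ
... | refl | refl = a ℤ.* b , refl

IsInt∩[0,1]⇒0⊎1 : ∀ {q} → IsInt q → 0ℚ ≤ q → q ≤ 1ℚ → q ≡ 0ℚ ⊎ q ≡ 1ℚ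
IsInt∩[0,1]⇒0⊎1 {mkℚ _ _ _} q∈ℤ _ _ with IsInt⇒denominator≡1 q∈ℤ
IsInt∩[0,1]⇒0⊎1 {mkℚ (ℤ.+ 0)           _ _} _ _        _                      | refl = inj₁ refl
IsInt∩[0,1]⇒0⊎1 {mkℚ (ℤ.+ 1)           _ _} _ _        _                      | refl = inj₂ refl
IsInt∩[0,1]⇒0⊎1 {mkℚ (ℤ.+ suc (suc _)) _ _} _ _        (*≤* (+≤+ (ℕ.s≤s ()))) | refl
IsInt∩[0,1]⇒0⊎1 {mkℚ -[1+ _ ]          _ _} _ (*≤* ()) _                      | refl

denominatorℚ : ℚ → ℚ
denominatorℚ q = mkℚ (ℤ.+ ↧ₙ q) 0 (coprime-sym (1-coprimeTo _))

1≤denominatorℚ : ∀ q → 1ℚ ≤ denominatorℚ q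
1≤denominatorℚ q = *≤* (+≤+ (ℕ.s≤s ℕ.z≤n))

IsInt-*-denominatorℚ : ∀ q → IsInt (q * denominatorℚ q)
IsInt-*-denominatorℚ q@(mkℚ z d-1 c) = subst IsInt (sym q*↧q≡z) (IsInt-mkℚ z c₁)
  where
  c₁ : Coprime ℤ.∣ z ∣ 1
  c₁ = coprime-sym (1-coprimeTo _)
  q*↧q≡z : q * denominatorℚ q ≡ mkℚ z 0 c₁
  q*↧q≡z = toℚᵘ-injective (ℚᵘ.≃-trans (toℚᵘ-homo-* q (denominatorℚ q))
    (ℚᵘ.*≡* (ℤ.*-assoc z (ℤ.+ suc d-1) (ℤ.+ 1))))

commonDenominator : ∀ k (q : Fin k → ℚ) → Σ[ K ∈ ℚ ] IsInt K × 1ℚ ≤ K × (∀ i → IsInt (K * q i))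
commonDenominator zero    q = 1ℚ , IsInt-mkℚ (ℤ.+ 1) _ , ≤-refl , λ ()
commonDenominator (suc k) q with commonDenominator k (q ∘ suc)
... | K , K∈ℤ , 1≤K , Kq∈ℤ = D * K , IsInt-* D∈ℤ K∈ℤ , 1≤DK , DKq∈ℤ
  where
  D = denominatorℚ (q zero)
  D∈ℤ : IsInt D
  D∈ℤ = IsInt-mkℚ _ _
  1≤DK : 1ℚ ≤ D * K
  1≤DK = ≤-trans (1≤denominatorℚ (q zero))
    (subst (_≤ D * K) (*-identityʳ D) (*-monoˡ-≤-nonNeg D 1≤K))
  DKq∈ℤ : ∀ i → IsInt (D * K * q i)
  DKq∈ℤ zero    = subst IsInt (solve 3 (λ D K q → K :* (q :* D) := D :* K :* q) refl D K (q zero))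
                    (IsInt-* K∈ℤ (IsInt-*-denominatorℚ (q zero)))
  DKq∈ℤ (suc i) = subst IsInt (sym (*-assoc D K (q (suc i)))) (IsInt-* D∈ℤ (Kq∈ℤ i))

IsInt-bit : ∀ β → IsInt (bit β)
IsInt-bit true  = IsInt-mkℚ _ _
IsInt-bit false = IsInt-mkℚ _ _

IsInt∩[0,1]⇒bit : ∀ {q} → IsInt q → 0ℚ ≤ q → q ≤ 1ℚ → q ≡ bit (does (q ≟ 1ℚ))
IsInt∩[0,1]⇒bit {q} q∈ℤ 0≤q q≤1 with q ≟ 1ℚ | IsInt∩[0,1]⇒0⊎1 q∈ℤ 0≤q q≤1
... | yes q≡1 | _        = q≡1
... | no  _   | inj₁ q≡0 = q≡0
... | no  q≢1 | inj₂ q≡1 = contradiction q≡1 q≢1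

sumFin-cong : ∀ {k} {f g : Fin k → ℚ} → (∀ i → f i ≡ g i) → sumFin k f ≡ sumFin k g
sumFin-cong {zero}  f≗g = refl
sumFin-cong {suc k} f≗g = cong₂ _+_ (f≗g zero) (sumFin-cong (f≗g ∘ suc))

sumFin-0 : ∀ k → sumFin k (λ _ → 0ℚ) ≡ 0ℚ
sumFin-0 zero    = refl
sumFin-0 (suc k) = cong (0ℚ +_) (sumFin-0 k)

sumFin-+ : ∀ k (f g : Fin k → ℚ) → sumFin k (λ i → f i + g i) ≡ sumFin k f + sumFin k g
sumFin-+ zero    f g = refl
sumFin-+ (suc k) f g = begin
  f zero + g zero + sumFin k (λ i → f (suc i) + g (suc i))
    ≡⟨ cong (f zero + g zero +_) (sumFin-+ k (f ∘ suc) (g ∘ suc)) ⟩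
  f zero + g zero + (sumFin k (f ∘ suc) + sumFin k (g ∘ suc))
    ≡⟨ solve 4 (λ a b c d → a :+ b :+ (c :+ d) := a :+ c :+ (b :+ d)) refl
         (f zero) (g zero) (sumFin k (f ∘ suc)) (sumFin k (g ∘ suc)) ⟩
  f zero + sumFin k (f ∘ suc) + (g zero + sumFin k (g ∘ suc)) ∎
  where open ≡-Reasoning

sumFin-neg : ∀ k (f : Fin k → ℚ) → sumFin k (λ i → - f i) ≡ - sumFin k f
sumFin-neg zero    f = refl
sumFin-neg (suc k) f =
  trans (cong (- f zero +_) (sumFin-neg k (f ∘ suc))) (sym (neg-distrib-+ (f zero) _))

sumFin-*ˡ : ∀ k c (f : Fin k → ℚ) → sumFin k (λ i → c * f i) ≡ c * sumFin k f
sumFin-*ˡ zero    c f = sym (*-zeroʳ c)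
sumFin-*ˡ (suc k) c f =
  trans (cong (c * f zero +_) (sumFin-*ˡ k c (f ∘ suc))) (sym (*-distribˡ-+ c _ _))

sumFin-*ʳ : ∀ k c (f : Fin k → ℚ) → sumFin k (λ i → f i * c) ≡ sumFin k f * c
sumFin-*ʳ k c f =
  trans (sumFin-cong (λ i → *-comm (f i) c)) (trans (sumFin-*ˡ k c f) (*-comm c _))

sumFin-comm : ∀ k l (f : Fin k → Fin l → ℚ) →
  sumFin k (λ i → sumFin l (f i)) ≡ sumFin l (λ j → sumFin k (λ i → f i j))
sumFin-comm zero    l f = sym (sumFin-0 l)
sumFin-comm (suc k) l f =
  trans (cong (sumFin l (f zero) +_) (sumFin-comm k l (f ∘ suc)))
        (sym (sumFin-+ l (f zero) (λ j → sumFin k (λ i → f (suc i) j))))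

sumFin-mono : ∀ k {f g : Fin k → ℚ} → (∀ i → f i ≤ g i) → sumFin k f ≤ sumFin k g
sumFin-mono zero    f≤g = ≤-refl
sumFin-mono (suc k) f≤g = +-mono-≤ (f≤g zero) (sumFin-mono k (f≤g ∘ suc))

sumFin-≤-≡ : ∀ k {f g : Fin k → ℚ} → (∀ i → f i ≤ g i) → sumFin k f ≡ sumFin k g →
  ∀ i → f i ≡ g i
sumFin-≤-≡ (suc k) {f} {g} f≤g Σf≡Σg zero = ≤-+-≡⇒≡ (f≤g zero) (sumFin-mono k (f≤g ∘ suc)) Σf≡Σg
sumFin-≤-≡ (suc k) {f} {g} f≤g Σf≡Σg (suc i) = sumFin-≤-≡ k (f≤g ∘ suc)
  (≤-+-≡⇒≡ (sumFin-mono k (f≤g ∘ suc)) (f≤g zero)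
    (trans (+-comm _ (f zero)) (trans Σf≡Σg (+-comm (g zero) _)))) i

sumFin-++ : ∀ k l (f : Fin k → ℚ) (g : Fin l → ℚ) →
  sumFin (k ℕ.+ l) (f ++ g) ≡ sumFin k f + sumFin l g
sumFin-++ zero    l f g = sym (+-identityˡ _)
sumFin-++ (suc k) l f g = begin
  f zero + sumFin (k ℕ.+ l) (λ i → (f ++ g) (suc i))
    ≡⟨ cong (f zero +_) (sumFin-cong (λ i → [,]-map (splitAt k i))) ⟩
  f zero + sumFin (k ℕ.+ l) ((f ∘ suc) ++ g)
    ≡⟨ cong (f zero +_) (sumFin-++ k l (f ∘ suc) g) ⟩
  f zero + (sumFin k (f ∘ suc) + sumFin l g)
    ≡⟨ sym (+-assoc (f zero) _ _) ⟩
  f zero + sumFin k (f ∘ suc) + sumFin l g ∎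
  where open ≡-Reasoning

sumFin≡1⇒positive : ∀ k {w : Fin k → ℚ} → (∀ j → 0ℚ ≤ w j) → sumFin k w ≡ 1ℚ →
  ∃ λ j → 0ℚ < w j
sumFin≡1⇒positive k {w} w≥0 Σw≡1 with any? (λ j → 0ℚ <? w j)
... | yes positive = positive
... | no  none = contradiction (trans (sym Σw≡1) (trans (sumFin-cong w≡0) (sumFin-0 k))) 1≢0
  where
  w≡0 : ∀ j → w j ≡ 0ℚ
  w≡0 j = ≤-antisym (≮⇒≥ (λ 0<wj → none (j , 0<wj))) (w≥0 j)

sumFin-*ʳ-1 : ∀ k {w : Fin k → ℚ} a → sumFin k w ≡ 1ℚ → sumFin k (λ j → w j * a) ≡ a
sumFin-*ʳ-1 k {w} a Σw≡1 = trans (sumFin-*ʳ k a w) (trans (cong (_* a) Σw≡1) (*-identityˡ a))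

infixl 6 _⊕_ _⊖_
infixl 7 _⊛_
infix  8 ⊝_

_⊕_ _⊖_ : ∀ {k} → Point k → Point k → Point k
(x ⊕ y) i = x i + y i
(x ⊖ y) i = x i - y i

_⊛_ : ∀ {k} → ℚ → Point k → Point k
(s ⊛ x) i = s * x i

⊝_ : ∀ {k} → Point k → Point k
(⊝ x) i = - x i

𝟘 : ∀ {k} → Point k
𝟘 _ = 0ℚ

basis : ∀ {k} → Fin k → Point k
basis zero    zero    = 1ℚ
basis zero    (suc _) = 0ℚ
basis (suc _) zero    = 0ℚ
basis (suc j) (suc i) = basis j i

module _ {k : ℕ} where

  ·-cong : ∀ (c : Point k) {x y} → x ≗ y → c · x ≡ c · y
  ·-cong c x≗y = sumFin-cong (λ i → cong (c i *_) (x≗y i))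

  ·-comm : ∀ (c x : Point k) → c · x ≡ x · c
  ·-comm c x = sumFin-cong (λ i → *-comm (c i) (x i))

  ·-⊕ʳ : ∀ (c x y : Point k) → c · (x ⊕ y) ≡ c · x + c · y
  ·-⊕ʳ c x y = trans (sumFin-cong (λ i → *-distribˡ-+ (c i) (x i) (y i))) (sumFin-+ k _ _)

  ·-⊛ʳ : ∀ (c : Point k) s x → c · (s ⊛ x) ≡ s * (c · x)
  ·-⊛ʳ c s x = trans (sumFin-cong (λ i → solve 3 (λ c s x → c :* (s :* x) := s :* (c :* x)) refl (c i) s (x i)))
                     (sumFin-*ˡ k s _)

  ·-⊝ʳ : ∀ (c x : Point k) → c · (⊝ x) ≡ - (c · x)
  ·-⊝ʳ c x = trans (sumFin-cong (λ i → sym (neg-distribʳ-* (c i) (x i)))) (sumFin-neg k _)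

  ·-⊖ʳ : ∀ (c x y : Point k) → c · (x ⊖ y) ≡ c · x - c · y
  ·-⊖ʳ c x y = trans (·-⊕ʳ c x (⊝ y)) (cong (c · x +_) (·-⊝ʳ c y))

  ·-⊛ˡ : ∀ s (x c : Point k) → (s ⊛ x) · c ≡ s * (x · c)
  ·-⊛ˡ s x c = trans (·-comm (s ⊛ x) c) (trans (·-⊛ʳ c s x) (cong (s *_) (·-comm c x)))

  ·-⊖ˡ : ∀ (x y c : Point k) → (x ⊖ y) · c ≡ x · c - y · c
  ·-⊖ˡ x y c = trans (·-comm (x ⊖ y) c) (trans (·-⊖ʳ c x y) (cong₂ _-_ (·-comm c x) (·-comm c y)))

  ·-zeroˡ : ∀ {c : Point k} → (∀ i → c i ≡ 0ℚ) → ∀ x → c · x ≡ 0ℚ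
  ·-zeroˡ c≡0 x = trans (sumFin-cong (λ i → trans (cong (_* x i) (c≡0 i)) (*-zeroˡ (x i)))) (sumFin-0 k)

  ·-Σˡ : ∀ l (a : Fin l → Point k) y →
    (λ i → sumFin l (λ j → a j i)) · y ≡ sumFin l (λ j → a j · y)
  ·-Σˡ l a y = trans (sumFin-cong (λ i → sym (sumFin-*ʳ l (y i) (λ j → a j i))))
                     (sumFin-comm k l (λ i j → a j i * y i))

  ·-Σʳ : ∀ (c : Point k) l (w : Fin l → ℚ) (p : Fin l → Point k) →
    c · (λ i → sumFin l (λ j → w j * p j i)) ≡ sumFin l (λ j → w j * (c · p j))
  ·-Σʳ c l w p = trans (·-comm c _) (trans (·-Σˡ l (λ j → w j ⊛ p j) c)
    (sumFin-cong (λ j → trans (·-⊛ˡ (w j) (p j) c) (cong (w j *_) (·-comm (p j) c)))))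

·-⊝ˡ : ∀ {k} (x y : Point k) → (⊝ x) · y ≡ - (x · y)
·-⊝ˡ x y = trans (·-comm (⊝ x) y) (trans (·-⊝ʳ y x) (cong -_ (·-comm y x)))

·-basisʳ : ∀ {k} (c : Point k) j → c · basis j ≡ c j
·-basisʳ {suc k} c zero = trans
  (cong₂ _+_ (*-identityʳ (c zero)) (trans (sumFin-cong (λ i → *-zeroʳ (c (suc i)))) (sumFin-0 k)))
  (+-identityʳ (c zero))
·-basisʳ {suc k} c (suc j) = trans (cong₂ _+_ (*-zeroʳ (c zero)) (·-basisʳ (c ∘ suc) j)) (+-identityˡ _)

·-basisˡ : ∀ {k} j (y : Point k) → basis j · y ≡ y j
·-basisˡ j y = trans (·-comm (basis j) y) (·-basisʳ y j)

·-⊕-⊛ : ∀ {k} (c x : Point k) t d → c · (x ⊕ t ⊛ d) ≡ c · x + t * (c · d)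
·-⊕-⊛ c x t d = trans (·-⊕ʳ c x (t ⊛ d)) (cong (c · x +_) (·-⊛ʳ c t d))

-- Kernels

InKernel : ∀ {r k} → (Fin r → Point k) → Point k → Set
InKernel a e = ∀ i → a i · e ≡ 0ℚ

InKernel-⊝ : ∀ {r k} {a : Fin r → Point k} {d} → InKernel a d → InKernel a (⊝ d)
InKernel-⊝ {a = a} {d} d∈ker i = trans (·-⊝ʳ (a i) d) (cong -_ (d∈ker i))

KerInclusion : ∀ {r s k} → (Fin r → Point k) → (Fin s → Point k) → Set
KerInclusion {k = k} a g =
  (Σ[ e ∈ Point k ] InKernel a e × ∃ λ j → g j · e ≢ 0ℚ) ⊎ (∀ e → InKernel a e → InKernel g e)

zero⊎nonzero : ∀ {k} (v : Point k) → (∀ i → v i ≡ 0ℚ) ⊎ ∃ λ i → v i ≢ 0ℚ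
zero⊎nonzero v with all? (λ i → v i ≟ 0ℚ)
... | yes v≡0 = inj₁ v≡0
... | no  v≢0 = inj₂ (¬∀⟶∃¬ _ _ (λ i → v i ≟ 0ℚ) v≢0)

module Elimination {r k} (a : Fin (suc r) → Point k) (p : Fin k) (fp≢0 : a zero p ≢ 0ℚ) where

  private
    f : Point k
    f = a zero

    ρ : ℚ
    ρ = recip (f p)

  project : Point k → Point k
  project u = u ⊖ (f · u * ρ) ⊛ basis p

  reduce : Point k → Point k
  reduce v = v ⊖ (v p * ρ) ⊛ f

  private
    ·-project : ∀ v u → v · project u ≡ v · u - f · u * ρ * v p
    ·-project v u = trans (·-⊖ʳ v u _)
      (cong (λ z → v · u - z) (trans (·-⊛ʳ v (f · u * ρ) (basis p)) (cong (f · u * ρ *_) (·-basisʳ v p))))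

  f·project : ∀ u → f · project u ≡ 0ℚ
  f·project u = begin
    f · project u               ≡⟨ ·-project f u ⟩
    f · u - f · u * ρ * f p
      ≡⟨ solve 3 (λ a ρ c → a :- a :* ρ :* c := a :* (con 1ℚ :- c :* ρ)) refl (f · u) ρ (f p) ⟩
    f · u * (1ℚ - f p * ρ)      ≡⟨ cong (λ z → f · u * (1ℚ - z)) (*-recipʳ fp≢0) ⟩
    f · u * (1ℚ - 1ℚ)           ≡⟨ solve 1 (λ a → a :* (con 1ℚ :- con 1ℚ) := con 0ℚ) refl (f · u) ⟩
    0ℚ                          ∎
    where open ≡-Reasoning

  project-ker : ∀ v {u} → f · u ≡ 0ℚ → v · project u ≡ v · u
  project-ker v {u} fu≡0 = trans (·-project v u)
    (trans (cong (λ z → v · u - z * ρ * v p) fu≡0)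
           (solve 3 (λ a ρ c → a :- con 0ℚ :* ρ :* c := a) refl (v · u) ρ (v p)))

  reduce-adjoint : ∀ v u → reduce v · u ≡ v · project u
  reduce-adjoint v u = begin
    reduce v · u                   ≡⟨ ·-⊖ˡ v _ u ⟩
    v · u - ((v p * ρ) ⊛ f) · u    ≡⟨ cong (λ z → v · u - z) (·-⊛ˡ (v p * ρ) f u) ⟩
    v · u - v p * ρ * (f · u)
      ≡⟨ solve 4 (λ a b ρ c → a :- b :* ρ :* c := a :- c :* ρ :* b) refl (v · u) (v p) ρ (f · u) ⟩
    v · u - f · u * ρ * v p        ≡⟨ sym (·-project v u) ⟩
    v · project u                  ∎
    where open ≡-Reasoning

  eliminate : ∀ {s} (g : Fin s → Point k) → KerInclusion (reduce ∘ a ∘ suc) (reduce ∘ g) → KerInclusion a g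
  eliminate g (inj₁ (e , e∈ker , j , ge≢0)) =
    inj₁ (project e , project-∈ker , j , ge≢0 ∘ trans (reduce-adjoint (g j) e))
    where
    project-∈ker : InKernel a (project e)
    project-∈ker zero    = f·project e
    project-∈ker (suc i) = trans (sym (reduce-adjoint (a (suc i)) e)) (e∈ker i)
  eliminate g (inj₂ ker⊆) = inj₂ λ e e∈ker j → begin
    g j · e              ≡⟨ sym (project-ker (g j) (e∈ker zero)) ⟩
    g j · project e      ≡⟨ sym (reduce-adjoint (g j) e) ⟩
    reduce (g j) · e     ≡⟨ ker⊆ e (λ i → trans (reduce-adjoint (a (suc i)) e)
                                    (trans (project-ker (a (suc i)) (e∈ker zero)) (e∈ker (suc i)))) j ⟩
    0ℚ                   ∎
    where open ≡-Reasoning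

ker⊆ker? : ∀ {r s k} (a : Fin r → Point k) (g : Fin s → Point k) → KerInclusion a g
ker⊆ker? {zero} a g with all? (λ j → all? (λ i → g j i ≟ 0ℚ))
... | yes g≡0 = inj₂ (λ e _ j → ·-zeroˡ (g≡0 j) e)
... | no  g≢0 with ¬∀⟶∃¬ _ _ (λ j → all? (λ i → g j i ≟ 0ℚ)) g≢0
...   | j , gj≢0 with zero⊎nonzero (g j)
...     | inj₁ gj≡0        = contradiction gj≡0 gj≢0
...     | inj₂ (i , gji≢0) = inj₁ (basis i , (λ ()) , j , gji≢0 ∘ trans (sym (·-basisʳ (g j) i)))
ker⊆ker? {suc r} a g with zero⊎nonzero (a zero)
... | inj₂ (p , a₀p≢0) = eliminate g (ker⊆ker? (reduce ∘ a ∘ suc) (reduce ∘ g))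
  where open Elimination a p a₀p≢0
... | inj₁ a₀≡0 with ker⊆ker? (a ∘ suc) g
...   | inj₁ (e , e∈ker , w) = inj₁ (e , (λ { zero → ·-zeroˡ a₀≡0 e ; (suc i) → e∈ker i }) , w)
...   | inj₂ ker⊆           = inj₂ (λ e e∈ker → ker⊆ e (e∈ker ∘ suc))

module Extrema = Data.List.Extrema (DecTotalOrder.totalOrder ≤-decTotalOrder)

argmin : ∀ {m} {P : Fin m → Set} → Decidable P → (f : Fin m → ℚ) → ∃ P →
  Σ[ j ∈ Fin m ] P j × (∀ i → P i → f j ≤ f i)
argmin {m} P? f (j , pj) =
  Extrema.argmin f j candidates ,
  Extrema.argmin-all f pj (all-filter P? (allFin m)) ,
  λ i pi → ListAll.lookup (Extrema.f[argmin]≤f[xs] j candidates) (∈-filter⁺ P? (∈-allFin i) pi)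
  where
  candidates = filter P? (allFin m)

subsetOf : ∀ {m} {P : Fin m → Set} → Decidable P → Subset m
subsetOf P? = tabulate (does ∘ P?)

∈-subsetOf⁺ : ∀ {m} {P : Fin m → Set} (P? : Decidable P) {j} → P j → j ∈ subsetOf P?
∈-subsetOf⁺ P? {j} pj = lookup⇒[]= j _ (trans (lookup∘tabulate (does ∘ P?) j) (dec-true (P? j) pj))

∈-subsetOf⁻ : ∀ {m} {P : Fin m → Set} (P? : Decidable P) {j} → j ∈ subsetOf P? → P j
∈-subsetOf⁻ P? {j} j∈ with P? j | trans (sym (lookup∘tabulate (does ∘ P?) j)) ([]=⇒lookup j∈)
... | yes pj | _ = pj
... | no  _  | ()

-- Convex hulls

zipWith-++ : ∀ {A B C : Set} (F : A → B → C) {k l} (f : Fin k → A) (g : Fin l → A) f′ g′ →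
  zipWith F (f ++ g) (f′ ++ g′) ≗ zipWith F f f′ ++ zipWith F g g′
zipWith-++ F {k} f g f′ g′ j with splitAt k j
... | inj₁ _ = refl
... | inj₂ _ = refl

-- conv X is definitionally NonnegComb X 1ℚ.
NonnegComb : ∀ {n} → PSet n → ℚ → PSet n
NonnegComb {n} X s x = Σ ℕ λ k → Σ (Fin k → Point n) λ p → Σ (Fin k → ℚ) λ w →
  (∀ j → X (p j)) × (∀ j → 0ℚ ≤ w j) × (sumFin k w ≡ s) ×
  (∀ i → x i ≡ sumFin k (λ j → w j * p j i))

module _ {n : ℕ} (X : PSet n) where

  private variable
    s t : ℚ
    x y : Point n

  nonnegComb-resp : s ≡ t → x ≗ y → NonnegComb X s x → NonnegComb X t y
  nonnegComb-resp s≡t x≗y (k , p , w , p∈X , w≥0 , Σw≡s , x≡) =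
    k , p , w , p∈X , w≥0 , trans Σw≡s s≡t , λ i → trans (sym (x≗y i)) (x≡ i)

  nonnegComb-+ : NonnegComb X s x → NonnegComb X t y → NonnegComb X (s + t) (x ⊕ y)
  nonnegComb-+ {x = x} {y = y} (k , p , w , p∈X , w≥0 , Σw≡s , x≡) (l , q , v , q∈X , v≥0 , Σv≡t , y≡) =
    k ℕ.+ l , p ++ q , w ++ v , VecAll.++⁺ X p∈X q∈X , VecAll.++⁺ (0ℚ ≤_) w≥0 v≥0 ,
    trans (sumFin-++ k l w v) (cong₂ _+_ Σw≡s Σv≡t) ,
    λ i → sym (begin
      sumFin (k ℕ.+ l) (λ j → (w ++ v) j * (p ++ q) j i)
        ≡⟨ sumFin-cong (zipWith-++ (λ a r → a * r i) w v p q) ⟩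
      sumFin (k ℕ.+ l) ((λ j → w j * p j i) ++ (λ j → v j * q j i))
        ≡⟨ sumFin-++ k l _ _ ⟩
      sumFin k (λ j → w j * p j i) + sumFin l (λ j → v j * q j i)
        ≡⟨ sym (cong₂ _+_ (x≡ i) (y≡ i)) ⟩
      x i + y i ∎)
    where open ≡-Reasoning

  nonnegComb-⊛ : ∀ {a} → 0ℚ ≤ a → NonnegComb X s x → NonnegComb X (a * s) (a ⊛ x)
  nonnegComb-⊛ {a = a} 0≤a (k , p , w , p∈X , w≥0 , Σw≡s , x≡) =
    k , p , (λ j → a * w j) , p∈X ,
    (λ j → *-nonNegative 0≤a (w≥0 j)) ,
    trans (sumFin-*ˡ k a w) (cong (a *_) Σw≡s) ,
    λ i → trans (cong (a *_) (x≡ i))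
      (sym (trans (sumFin-cong (λ j → *-assoc a (w j) (p j i))) (sumFin-*ˡ k a _)))

  nonnegComb-Σ : ∀ k (p : Fin k → Point n) (w : Fin k → ℚ) →
    (∀ j → conv X (p j)) → (∀ j → 0ℚ ≤ w j) →
    NonnegComb X (sumFin k w) (λ i → sumFin k (λ j → w j * p j i))
  nonnegComb-Σ zero    p w p∈ w≥0 = 0 , (λ ()) , (λ ()) , (λ ()) , (λ ()) , refl , λ _ → refl
  nonnegComb-Σ (suc k) p w p∈ w≥0 =
    nonnegComb-resp (cong (_+ sumFin k (w ∘ suc)) (*-identityʳ (w zero))) (λ _ → refl)
      (nonnegComb-+ (nonnegComb-⊛ (w≥0 zero) (p∈ zero))
                    (nonnegComb-Σ k (p ∘ suc) (w ∘ suc) (p∈ ∘ suc) (w≥0 ∘ suc)))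

  conv-flatten : conv (conv X) x → conv X x
  conv-flatten (k , p , w , p∈ , w≥0 , Σw≡1 , x≡) =
    nonnegComb-resp Σw≡1 (λ i → sym (x≡ i)) (nonnegComb-Σ k p w p∈ w≥0)

  conv-point : X x → conv X x
  conv-point {x = x} x∈X =
    1 , (λ _ → x) , (λ _ → 1ℚ) , (λ _ → x∈X) , (λ _ → nonNegative⁻¹ 1ℚ) , +-identityʳ 1ℚ ,
    λ i → sym (trans (+-identityʳ _) (*-identityˡ (x i)))

  conv-≗ : x ≗ y → conv X x → conv X y
  conv-≗ = nonnegComb-resp refl

  conv-nonempty : conv X x → Nonempty X
  conv-nonempty (zero  , _ , _ , _   , _ , 0≡1 , _) = contradiction (sym 0≡1) 1≢0
  conv-nonempty (suc _ , p , _ , p∈X , _)           = p zero , p∈X zero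

  conv-pair : ∀ {a b z} → 0ℚ ≤ a → 0ℚ ≤ b → a + b ≡ 1ℚ →
    conv X y → conv X z → conv X (a ⊛ y ⊕ b ⊛ z)
  conv-pair {a = a} {b} 0≤a 0≤b a+b≡1 y∈ z∈ =
    nonnegComb-resp (trans (cong₂ _+_ (*-identityʳ a) (*-identityʳ b)) a+b≡1) (λ _ → refl)
      (nonnegComb-+ (nonnegComb-⊛ 0≤a y∈) (nonnegComb-⊛ 0≤b z∈))

  conv-segment : ∀ {d} → 0ℚ < s → 0ℚ < t → conv X (x ⊕ s ⊛ d) → conv X (x ⊕ t ⊛ ⊝ d) → conv X x
  conv-segment {s} {t} {x = x} {d} 0<s 0<t x+sd∈ x-td∈ =
    conv-≗ x≡ (conv-pair {a = t * ρ} {b = s * ρ} (<⇒≤ 0<tρ) (<⇒≤ 0<sρ) weights≡1 x+sd∈ x-td∈)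
    where
    0<s+t : 0ℚ < s + t
    0<s+t = subst (_< s + t) (+-identityʳ 0ℚ) (+-mono-< 0<s 0<t)
    ρ = recip (s + t)
    0<ρ : 0ℚ < ρ
    0<ρ = recip-pos 0<s+t
    0<tρ : 0ℚ < t * ρ
    0<tρ = *-positive 0<t 0<ρ
    0<sρ : 0ℚ < s * ρ
    0<sρ = *-positive 0<s 0<ρ
    [s+t]ρ≡1 : (s + t) * ρ ≡ 1ℚ
    [s+t]ρ≡1 = *-recipʳ (≢-sym (<⇒≢ 0<s+t))
    weights≡1 : t * ρ + s * ρ ≡ 1ℚ
    weights≡1 = trans (solve 3 (λ s t ρ → t :* ρ :+ s :* ρ := (s :+ t) :* ρ) refl s t ρ) [s+t]ρ≡1
    x≡ : ∀ i → (t * ρ) * (x i + s * d i) + (s * ρ) * (x i + t * - d i) ≡ x i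
    x≡ i = trans (solve 5 (λ s t ρ x d → t :* ρ :* (x :+ s :* d) :+ s :* ρ :* (x :+ t :* (:- d)) := (s :+ t) :* ρ :* x)
                    refl s t ρ (x i) (d i))
                 (trans (cong (_* x i) [s+t]ρ≡1) (*-identityˡ (x i)))

conv-mono : ∀ {n} {X Y : PSet n} {x} → (∀ y → X y → Y y) → conv X x → conv Y x
conv-mono X⊆Y (k , p , w , p∈X , rest) = k , p , w , (λ j → X⊆Y (p j) (p∈X j)) , rest

conv-translate : ∀ {n} {X : PSet n} {y v} → (∀ p → X p → X (p ⊕ v)) → conv X y → conv X (y ⊕ v)
conv-translate {y = y} {v} X+v⊆X (k , p , w , p∈X , w≥0 , Σw≡1 , y≡) =
  k , (λ j → p j ⊕ v) , w , (λ j → X+v⊆X (p j) (p∈X j)) , w≥0 , Σw≡1 , λ i → sym (begin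
    sumFin k (λ j → w j * (p j i + v i))
      ≡⟨ sumFin-cong (λ j → *-distribˡ-+ (w j) (p j i) (v i)) ⟩
    sumFin k (λ j → w j * p j i + w j * v i)
      ≡⟨ sumFin-+ k _ _ ⟩
    sumFin k (λ j → w j * p j i) + sumFin k (λ j → w j * v i)
      ≡⟨ cong₂ _+_ (sym (y≡ i)) (sumFin-*ʳ-1 k (v i) Σw≡1) ⟩
    y i + v i ∎)
  where open ≡-Reasoning

conv-halfspace : ∀ {n} {X : PSet n} {x} c {β} → (∀ y → X y → c · y ≤ β) → conv X x → c · x ≤ β
conv-halfspace {x = x} c {β} X⊆H (k , p , w , p∈X , w≥0 , Σw≡1 , x≡) = begin
  c · x                            ≡⟨ trans (·-cong c x≡) (·-Σʳ c k w p) ⟩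
  sumFin k (λ j → w j * (c · p j))
    ≤⟨ sumFin-mono k (λ j → *-monoˡ-≤-nonNeg (w j) {{nonNegative (w≥0 j)}} (X⊆H (p j) (p∈X j))) ⟩
  sumFin k (λ j → w j * β)          ≡⟨ sumFin-*ʳ-1 k β Σw≡1 ⟩
  β                                 ∎
  where open ≤-Reasoning

conv-face : ∀ {n} {X : PSet n} {x} {I : Set} (c : I → Point n) (β : I → ℚ) →
  (∀ t y → X y → c t · y ≤ β t) → (∀ t → c t · x ≡ β t) →
  conv X x → conv (λ y → X y × ∀ t → c t · y ≡ β t) x
conv-face {n} {X} {x} c β valid tight (k , p , w , p∈X , w≥0 , Σw≡1 , x≡) =
  k , p′ , w , p′∈ , w≥0 , Σw≡1 , λ i → trans (x≡ i) (sumFin-cong (w*p≡w*p′ i))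
  where
  positive⇒tight : ∀ j → 0ℚ < w j → ∀ t → c t · p j ≡ β t
  positive⇒tight j 0<wj t = *-cancelˡ-≡-pos 0<wj (sumFin-≤-≡ k
    (λ j → *-monoˡ-≤-nonNeg (w j) {{nonNegative (w≥0 j)}} (valid t (p j) (p∈X j)))
    (begin
      sumFin k (λ j → w j * (c t · p j)) ≡⟨ sym (trans (·-cong (c t) x≡) (·-Σʳ (c t) k w p)) ⟩
      c t · x                            ≡⟨ tight t ⟩
      β t                                ≡⟨ sym (sumFin-*ʳ-1 k (β t) Σw≡1) ⟩
      sumFin k (λ j → w j * β t)         ∎) j)
    where open ≡-Reasoning
  j₀ = proj₁ (sumFin≡1⇒positive k w≥0 Σw≡1)
  0<wj₀ = proj₂ (sumFin≡1⇒positive k w≥0 Σw≡1)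
  -- points of weight zero are replaced by a point of positive weight
  p′ : Fin k → Point n
  p′ j with 0ℚ <? w j
  ... | yes _ = p j
  ... | no  _ = p j₀
  p′∈ : ∀ j → X (p′ j) × ∀ t → c t · p′ j ≡ β t
  p′∈ j with 0ℚ <? w j
  ... | yes 0<wj = p∈X j , positive⇒tight j 0<wj
  ... | no  _    = p∈X j₀ , positive⇒tight j₀ 0<wj₀
  w*p≡w*p′ : ∀ i j → w j * p j i ≡ w j * p′ j i
  w*p≡w*p′ i j with 0ℚ <? w j
  ... | yes _   = refl
  ... | no  w≯0 = w≡0⇒w*p≡w*q (p j i) (p j₀ i) (≤-antisym (≮⇒≥ w≯0) (w≥0 j))

module _ {n : ℕ} where

  ≐-sym : ∀ {X Y : PSet n} → X ≐ Y → Y ≐ X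
  ≐-sym X≐Y x = proj₂ (X≐Y x) , proj₁ (X≐Y x)

  IsFace-resp-≐ : ∀ {Q Q′ F : PSet n} → Q ≐ Q′ → IsFace Q F → IsFace Q′ F
  IsFace-resp-≐ Q≐Q′ (c , δ , valid , F≐) =
    c , δ , (λ x x∈Q′ → valid x (proj₂ (Q≐Q′ x) x∈Q′)) ,
    λ x → (λ x∈F → let (x∈Q , cx≡δ) = proj₁ (F≐ x) x∈F in proj₁ (Q≐Q′ x) x∈Q , cx≡δ) ,
          (λ (x∈Q′ , cx≡δ) → proj₂ (F≐ x) (proj₂ (Q≐Q′ x) x∈Q′ , cx≡δ))

  IsMinimalFace-resp-≐ : ∀ {Q Q′ F : PSet n} → Q ≐ Q′ → IsMinimalFace Q F → IsMinimalFace Q′ F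
  IsMinimalFace-resp-≐ Q≐Q′ (F-face , F≢∅ , minimal) =
    IsFace-resp-≐ Q≐Q′ F-face , F≢∅ , λ G G-face → minimal G (IsFace-resp-≐ (≐-sym Q≐Q′) G-face)

  TIntegral-resp-≐ : ∀ {T} {Q Q′ : PSet n} → Q ≐ Q′ → TIntegral T Q → TIntegral T Q′
  TIntegral-resp-≐ {T} {Q} {Q′} Q≐Q′ Q-int x =
    (λ x∈Q′ → conv-mono {X = Q ∩ 𝓜 T} (λ y (y∈Q , y∈𝓜) → proj₁ (Q≐Q′ y) y∈Q , y∈𝓜)
                (proj₁ (Q-int x) (proj₂ (Q≐Q′ x) x∈Q′))) ,
    (λ x∈hull → proj₁ (Q≐Q′ x) (proj₂ (Q-int x)
                  (conv-mono {X = Q′ ∩ 𝓜 T} (λ y (y∈Q′ , y∈𝓜) → proj₂ (Q≐Q′ y) y∈Q′ , y∈𝓜) x∈hull)))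

  TIntegral⇒face-meets-𝓜 : ∀ {T} {Q F : PSet n} → TIntegral T Q → IsFace Q F → Nonempty F →
    Nonempty (F ∩ 𝓜 T)
  TIntegral⇒face-meets-𝓜 {T} {Q} Q-int (c , δ , valid , F≐) (x , x∈F) with proj₁ (F≐ x) x∈F
  ... | x∈Q , cx≡δ with conv-nonempty (λ y → (Q ∩ 𝓜 T) y × (⊤ → c · y ≡ δ))
        (conv-face {X = Q ∩ 𝓜 T} (λ (_ : ⊤) → c) (λ _ → δ) (λ _ y (y∈Q , _) → valid y y∈Q) (λ _ → cx≡δ)
          (proj₁ (Q-int x) x∈Q))
  ... | y , (y∈Q , y∈𝓜) , cy≡δ = y , proj₂ (F≐ y) (y∈Q , cy≡δ tt) , y∈𝓜

-- Polyhedra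

module _ {n : ℕ} (P : Polyhedron n) where

  open Polyhedron P

  Tight : Point n → Fin m → Set
  Tight x j = A j · x ≡ b j

  tightRows : Point n → Subset m
  tightRows x = subsetOf (λ j → A j · x ≟ b j)

  ∈tightRows⁺ : ∀ x {j} → Tight x j → j ∈ tightRows x
  ∈tightRows⁺ x = ∈-subsetOf⁺ (λ j → A j · x ≟ b j)

  ∈tightRows⁻ : ∀ x {j} → j ∈ tightRows x → Tight x j
  ∈tightRows⁻ x = ∈-subsetOf⁻ (λ j → A j · x ≟ b j)

  Recession : Point n → Set
  Recession d = ∀ j → A j · d ≤ 0ℚ

  recession-⊛ : ∀ {t d} → 0ℚ ≤ t → Recession d → Recession (t ⊛ d)
  recession-⊛ {t} {d} 0≤t rec j = subst (_≤ 0ℚ) (sym (·-⊛ʳ (A j) t d)) (*-nonPositive 0≤t (rec j))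

  ∈P-⊕-recession : ∀ {x d} → x ∈P P → Recession d → (x ⊕ d) ∈P P
  ∈P-⊕-recession {x} {d} x∈P rec j = begin
    A j · (x ⊕ d)       ≡⟨ ·-⊕ʳ (A j) x d ⟩
    A j · x + A j · d   ≤⟨ +-mono-≤ (x∈P j) (rec j) ⟩
    b j + 0ℚ            ≡⟨ +-identityʳ (b j) ⟩
    b j                 ∎
    where open ≤-Reasoning

  conv⟦⟧⊆⟦⟧ : ∀ {x} → conv ⟦ P ⟧ x → x ∈P P
  conv⟦⟧⊆⟦⟧ x∈ j = conv-halfspace {X = ⟦ P ⟧} (A j) (λ y y∈P → y∈P j) x∈

  ⊆conv⇒TIntegral : ∀ {T} {Q : PSet n} → Q ≐ ⟦ P ⟧ → (∀ x → Q x → conv (Q ∩ 𝓜 T) x) → TIntegral T Q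
  ⊆conv⇒TIntegral {T} {Q} Q≐P Q⊆hull x = Q⊆hull x , λ x∈hull → proj₂ (Q≐P x)
    (conv⟦⟧⊆⟦⟧ (conv-mono {X = Q ∩ 𝓜 T} (λ y (y∈Q , _) → proj₁ (Q≐P y) y∈Q) x∈hull))

  -- a junk value unless 0 < A j · d
  hitTime : Point n → Point n → Fin m → ℚ
  hitTime x d j = (b j - A j · x) * recip (A j · d)

  hitTime-tight : ∀ {x d j} → 0ℚ < A j · d → A j · x + hitTime x d j * (A j · d) ≡ b j
  hitTime-tight {x} {d} {j} 0<Ajd = p+[q-p]*r⁻¹*r≡q (A j · x) (b j) (≢-sym (<⇒≢ 0<Ajd))

  ⊕⊛-∈P : ∀ {x d t} → x ∈P P → 0ℚ ≤ t → (∀ j → 0ℚ < A j · d → t ≤ hitTime x d j) →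
    (x ⊕ t ⊛ d) ∈P P
  ⊕⊛-∈P {x} {d} {t} x∈P 0≤t t≤hitTime j with 0ℚ <? A j · d
  ... | yes 0<Ajd = begin
    A j · (x ⊕ t ⊛ d)                    ≡⟨ ·-⊕-⊛ (A j) x t d ⟩
    A j · x + t * (A j · d)
      ≤⟨ +-monoʳ-≤ (A j · x) (*-monoʳ-≤-nonNeg (A j · d) {{nonNegative (<⇒≤ 0<Ajd)}} (t≤hitTime j 0<Ajd)) ⟩
    A j · x + hitTime x d j * (A j · d)  ≡⟨ hitTime-tight 0<Ajd ⟩
    b j                                  ∎
    where open ≤-Reasoning
  ... | no  Ajd≯0 = begin
    A j · (x ⊕ t ⊛ d)                    ≡⟨ ·-⊕-⊛ (A j) x t d ⟩
    A j · x + t * (A j · d)              ≤⟨ +-mono-≤ (x∈P j) (*-nonPositive 0≤t (≮⇒≥ Ajd≯0)) ⟩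
    b j + 0ℚ                             ≡⟨ +-identityʳ (b j) ⟩
    b j                                  ∎
    where open ≤-Reasoning

  ⊕⊛-tight : ∀ {x d j} t → Tight x j → A j · d ≡ 0ℚ → Tight (x ⊕ t ⊛ d) j
  ⊕⊛-tight {x} {d} {j} t tight Ajd≡0 = begin
    A j · (x ⊕ t ⊛ d)        ≡⟨ ·-⊕-⊛ (A j) x t d ⟩
    A j · x + t * (A j · d)  ≡⟨ cong₂ (λ a c → a + t * c) tight Ajd≡0 ⟩
    b j + t * 0ℚ             ≡⟨ solve 2 (λ β t → β :+ t :* con 0ℚ := β) refl (b j) t ⟩
    b j                      ∎
    where open ≡-Reasoning

  Step : Point n → Point n → Set
  Step x d = Σ[ t ∈ ℚ ] 0ℚ < t × (x ⊕ t ⊛ d) ∈P P × tightRows x ⊂ tightRows (x ⊕ t ⊛ d)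

  earliest-step : ∀ {x d} → x ∈P P → (∀ j → Tight x j → A j · d ≡ 0ℚ) →
    ∀ j₀ → 0ℚ < A j₀ · d → (∀ j → 0ℚ < A j · d → hitTime x d j₀ ≤ hitTime x d j) → Step x d
  earliest-step {x} {d} x∈P d⊥tight j₀ 0<Aj₀d earliest =
    t , 0<t , ⊕⊛-∈P x∈P (<⇒≤ 0<t) earliest , stays-tight , j₀ , j₀-tight , j₀∉tightRows
    where
    t = hitTime x d j₀
    j₀-slack : A j₀ · x < b j₀
    j₀-slack = ≤∧≢⇒< (x∈P j₀) (λ tight → <⇒≢ 0<Aj₀d (sym (d⊥tight j₀ tight)))
    0<t : 0ℚ < t
    0<t = *-positive (p<q⇒0<q-p j₀-slack) (recip-pos 0<Aj₀d)
    stays-tight : tightRows x ⊆ tightRows (x ⊕ t ⊛ d)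
    stays-tight j∈ = ∈tightRows⁺ _ (⊕⊛-tight t (∈tightRows⁻ x j∈) (d⊥tight _ (∈tightRows⁻ x j∈)))
    j₀-tight : j₀ ∈ tightRows (x ⊕ t ⊛ d)
    j₀-tight = ∈tightRows⁺ _ (trans (·-⊕-⊛ (A j₀) x t d) (hitTime-tight 0<Aj₀d))
    j₀∉tightRows : j₀ ∉ tightRows x
    j₀∉tightRows j₀∈ = <⇒≢ j₀-slack (∈tightRows⁻ x j₀∈)

  step-or-recession : ∀ {x d} → x ∈P P → (∀ j → Tight x j → A j · d ≡ 0ℚ) → Step x d ⊎ Recession d
  step-or-recession {x} {d} x∈P d⊥tight with any? (λ j → 0ℚ <? A j · d)
  ... | no  none = inj₂ (λ j → ≮⇒≥ (λ 0<Ajd → none (j , 0<Ajd)))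
  ... | yes some =
    let j₀ , 0<Aj₀d , earliest = argmin (λ j → 0ℚ <? A j · d) (hitTime x d) some
    in  inj₁ (earliest-step x∈P d⊥tight j₀ 0<Aj₀d earliest)

  face-lineality : ∀ {G g y} → IsFace ⟦ P ⟧ G → G g → InKernel A (y ⊖ g) → G y
  face-lineality {G} {g} {y} (c , δ , valid , G≐) g∈G y-g∈ker = proj₂ (G≐ y) (y∈P , cy≡δ)
    where
    g∈P = proj₁ (proj₁ (G≐ g) g∈G)
    cg≡δ = proj₂ (proj₁ (G≐ g) g∈G)
    Ay≡Ag : ∀ j → A j · y ≡ A j · g
    Ay≡Ag j = x∙y⁻¹≈ε⇒x≈y _ _ (trans (sym (·-⊖ʳ (A j) y g)) (y-g∈ker j))
    y∈P : y ∈P P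
    y∈P j = subst (_≤ b j) (sym (Ay≡Ag j)) (g∈P j)
    -- y and its reflection z through g satisfy c · _ ≤ δ and average to g, where c · g ≡ δ
    z = g ⊕ (g ⊖ y)
    ·z : ∀ c → c · z ≡ c · g + (c · g - c · y)
    ·z c = trans (·-⊕ʳ c g (g ⊖ y)) (cong (c · g +_) (·-⊖ʳ c g y))
    z∈P : z ∈P P
    z∈P j = subst (_≤ b j) (sym (trans (·z (A j)) (trans (cong (λ a → A j · g + (A j · g - a)) (Ay≡Ag j))
      (solve 1 (λ a → a :+ (a :- a) := a) refl (A j · g))))) (g∈P j)
    cy≡δ : c · y ≡ δ
    cy≡δ = ≤-+-≡⇒≡ (valid y y∈P) (valid z z∈P) (begin
      c · y + c · z                  ≡⟨ cong (c · y +_) (·z c) ⟩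
      c · y + (c · g + (c · g - c · y))
        ≡⟨ solve 2 (λ a r → a :+ (r :+ (r :- a)) := r :+ r) refl (c · y) (c · g) ⟩
      c · g + c · g                  ≡⟨ cong₂ _+_ cg≡δ cg≡δ ⟩
      δ + δ                          ∎)
      where open ≡-Reasoning

  tightRow : Point n → Fin m → Point n
  tightRow x j with A j · x ≟ b j
  ... | yes _ = A j
  ... | no  _ = 𝟘

  tightRhs : Point n → Fin m → ℚ
  tightRhs x j with A j · x ≟ b j
  ... | yes _ = b j
  ... | no  _ = 0ℚ

  tightRow-valid : ∀ x {y} j → y ∈P P → tightRow x j · y ≤ tightRhs x j
  tightRow-valid x {y} j y∈P with A j · x ≟ b j
  ... | yes _ = y∈P j
  ... | no  _ = ≤-reflexive (·-zeroˡ (λ _ → refl) y)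

  tightRow-at : ∀ x j → tightRow x j · x ≡ tightRhs x j
  tightRow-at x j with A j · x ≟ b j
  ... | yes tight = tight
  ... | no  _     = ·-zeroˡ (λ _ → refl) x

  tightRow-kernel : ∀ {x d} → InKernel (tightRow x) d → ∀ j → Tight x j → A j · d ≡ 0ℚ
  tightRow-kernel {x} d∈ker j tight with A j · x ≟ b j | d∈ker j
  ... | yes _ | Ad≡0 = Ad≡0
  ... | no  slack | _ = contradiction tight slack

  -- the smallest face of P containing x
  tightNormal : Point n → Point n
  tightNormal x i = sumFin m (λ j → tightRow x j i)

  tightLevel : Point n → ℚ
  tightLevel x = sumFin m (tightRhs x)

  tightFace : Point n → PSet n
  tightFace x y = y ∈P P × tightNormal x · y ≡ tightLevel x

  tightFace-rows : ∀ {x y} → tightFace x y → ∀ j → tightRow x j · y ≡ tightRhs x j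
  tightFace-rows {x} {y} (y∈P , sum-tight) =
    sumFin-≤-≡ m (λ j → tightRow-valid x j y∈P) (trans (sym (·-Σˡ m (tightRow x) y)) sum-tight)

  tightFace-⊖ : ∀ {x y z} → tightFace x y → tightFace x z → InKernel (tightRow x) (y ⊖ z)
  tightFace-⊖ {x} {y} {z} y∈F z∈F j = trans (·-⊖ʳ (tightRow x j) y z)
    (x≈y⇒x∙y⁻¹≈ε (trans (tightFace-rows y∈F j) (sym (tightFace-rows z∈F j))))

  ∈tightFace : ∀ {x} → x ∈P P → tightFace x x
  ∈tightFace {x} x∈P = x∈P , trans (·-Σˡ m (tightRow x) x) (sumFin-cong (tightRow-at x))

  tightFace-minimal : ∀ {x} → x ∈P P → (∀ e → InKernel (tightRow x) e → InKernel A e) →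
    IsMinimalFace ⟦ P ⟧ (tightFace x)
  tightFace-minimal {x} x∈P ker⊆ =
    (tightNormal x , tightLevel x , (λ y y∈P → valid y∈P) , λ _ → id , id) , (x , ∈tightFace x∈P) ,
    λ G G-face (g , g∈G) G⊆F y y∈F →
      face-lineality G-face g∈G (ker⊆ (y ⊖ g) (tightFace-⊖ y∈F (G⊆F g g∈G)))
    where
    valid : ∀ {y} → y ∈P P → tightNormal x · y ≤ tightLevel x
    valid {y} y∈P = subst (_≤ tightLevel x) (sym (·-Σˡ m (tightRow x) y))
      (sumFin-mono m (λ j → tightRow-valid x j y∈P))

  module _ (T : Subset n) where

    private
      Y : PSet n
      Y = ⟦ P ⟧ ∩ 𝓜 T

    -- K ⊛ d is integral, so y ⊕ K ⊛ d ∈ conv Y, and y ⊕ d lies between y and y ⊕ K ⊛ d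
    conv-recession : ∀ {y d} → Recession d → conv Y y → conv Y (y ⊕ d)
    conv-recession {y} {d} rec y∈ with commonDenominator n d
    ... | K , _ , 1≤K , Kd∈ℤ =
      conv-≗ Y y+d≗ (conv-pair Y (p≤q⇒0≤q-p μ≤1) (<⇒≤ 0<μ) 1-μ+μ≡1 y∈ y+Kd∈)
      where
      0<K : 0ℚ < K
      0<K = <-≤-trans (positive⁻¹ 1ℚ) 1≤K
      μ = recip K
      0<μ : 0ℚ < μ
      0<μ = recip-pos 0<K
      Kμ≡1 : K * μ ≡ 1ℚ
      Kμ≡1 = *-recipʳ (≢-sym (<⇒≢ 0<K))
      μ≤1 : μ ≤ 1ℚ
      μ≤1 = subst₂ _≤_ (*-identityʳ μ) (trans (*-comm μ K) Kμ≡1)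
        (*-monoˡ-≤-nonNeg μ {{nonNegative (<⇒≤ 0<μ)}} 1≤K)
      1-μ+μ≡1 : 1ℚ - μ + μ ≡ 1ℚ
      1-μ+μ≡1 = solve 1 (λ l → con 1ℚ :- l :+ l := con 1ℚ) refl μ
      y+Kd∈ : conv Y (y ⊕ K ⊛ d)
      y+Kd∈ = conv-translate {X = Y} (λ p (p∈P , p∈𝓜) →
        ∈P-⊕-recession p∈P (recession-⊛ (<⇒≤ 0<K) rec) , λ i i∈T → IsInt-+ (p∈𝓜 i i∈T) (Kd∈ℤ i)) y∈
      y+d≗ : (1ℚ - μ) ⊛ y ⊕ μ ⊛ (y ⊕ K ⊛ d) ≗ y ⊕ d
      y+d≗ i = trans
        (solve 4 (λ l y K d → (con 1ℚ :- l) :* y :+ l :* (y :+ K :* d) := y :+ (K :* l) :* d) refl μ (y i) K (d i))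
        (trans (cong (λ c → y i + c * d i) Kμ≡1) (cong (y i +_) (*-identityˡ (d i))))

    -- walk from x along d and along ⊝ d until a new row becomes tight; a side on which
    -- none does is a recession direction
    conv-through-line : ∀ {x d j} → (∀ y → y ∈P P → tightRows x ⊂ tightRows y → conv Y y) →
      x ∈P P → InKernel (tightRow x) d → A j · d ≢ 0ℚ → conv Y x
    conv-through-line {x} {d} {j} IH x∈P d∈ker Ajd≢0
      with step-or-recession x∈P (tightRow-kernel d∈ker)
         | step-or-recession x∈P (tightRow-kernel (InKernel-⊝ {a = tightRow x} d∈ker))
    ... | inj₁ (s , 0<s , y∈P , x⊂y) | inj₁ (t , 0<t , z∈P , x⊂z) =
      conv-segment Y 0<s 0<t (IH _ y∈P x⊂y) (IH _ z∈P x⊂z)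
    ... | inj₁ (s , 0<s , y∈P , x⊂y) | inj₂ rec =
      conv-≗ Y (λ i → solve 3 (λ x s d → x :+ s :* d :+ s :* (:- d) := x) refl (x i) s (d i))
        (conv-recession (recession-⊛ (<⇒≤ 0<s) rec) (IH _ y∈P x⊂y))
    ... | inj₂ rec | inj₁ (t , 0<t , z∈P , x⊂z) =
      conv-≗ Y (λ i → solve 3 (λ x t d → x :+ t :* (:- d) :+ t :* d := x) refl (x i) t (d i))
        (conv-recession (recession-⊛ (<⇒≤ 0<t) rec) (IH _ z∈P x⊂z))
    ... | inj₂ rec | inj₂ rec⊝ =
      contradiction (≤-antisym (rec j) (neg-cancel-≤ (subst (_≤ 0ℚ) (·-⊝ʳ (A j) d) (rec⊝ j)))) Ajd≢0

    conv-from-tightFace : ∀ {x} → x ∈P P → (∀ e → InKernel (tightRow x) e → InKernel A e) →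
      Nonempty (tightFace x ∩ 𝓜 T) → conv Y x
    conv-from-tightFace {x} x∈P ker⊆ (z , z∈F , z∈𝓜) =
      conv-≗ Y (λ i → solve 2 (λ z x → z :+ (x :- z) := x) refl (z i) (x i))
        (conv-recession (λ j → ≤-reflexive (x-z∈ker j)) (conv-point Y (proj₁ z∈F , z∈𝓜)))
      where
      x-z∈ker : InKernel A (x ⊖ z)
      x-z∈ker = ker⊆ (x ⊖ z) (tightFace-⊖ (∈tightFace x∈P) z∈F)

    minimalFaces⇒TIntegral : (∀ F → IsMinimalFace ⟦ P ⟧ F → Nonempty (F ∩ 𝓜 T)) → TIntegral T ⟦ P ⟧
    minimalFaces⇒TIntegral meets =
      ⊆conv⇒TIntegral (λ _ → id , id) (λ x → go x (On.wellFounded tightRows ⊃-wellFounded x))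
      where
      go : ∀ x → Acc (_⊃_ on tightRows) x → x ∈P P → conv Y x
      go x (acc more) x∈P with ker⊆ker? (tightRow x) A
      ... | inj₁ (d , d∈ker , j , Ajd≢0) =
        conv-through-line (λ y y∈P x⊂y → go y (more x⊂y) y∈P) x∈P d∈ker Ajd≢0
      ... | inj₂ ker⊆ = conv-from-tightFace x∈P ker⊆ (meets _ (tightFace-minimal x∈P ker⊆))

-- Fibers

module Fibers {n : ℕ} (P : Polyhedron n) (S : Subset n) (cube : InUnitCubeOn S P) where

  open Polyhedron P

  module _ (x̄ : Fin n → Bool) where

    fiber⊆𝓜 : ∀ {y} → (∀ i → i ∈ S → y i ≡ bit (x̄ i)) → 𝓜 S y
    fiber⊆𝓜 y∈fiber i i∈S = subst IsInt (sym (y∈fiber i i∈S)) (IsInt-bit (x̄ i))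

    facetRow : Fin n → Point n
    facetRow i with i ∈? S | x̄ i
    ... | yes _ | true  = basis i
    ... | yes _ | false = ⊝ basis i
    ... | no  _ | _     = 𝟘

    facetRhs : Fin n → ℚ
    facetRhs i with i ∈? S | x̄ i
    ... | yes _ | true  = 1ℚ
    ... | yes _ | false = 0ℚ
    ... | no  _ | _     = 0ℚ

    facet-valid : ∀ {y} → y ∈P P → ∀ i → facetRow i · y ≤ facetRhs i
    facet-valid {y} y∈P i with i ∈? S | x̄ i
    ... | yes i∈S | true  = subst (_≤ 1ℚ) (sym (·-basisˡ i y)) (proj₂ (cube y y∈P i i∈S))
    ... | yes i∈S | false = subst (_≤ 0ℚ) (sym (trans (·-⊝ˡ (basis i) y) (cong -_ (·-basisˡ i y))))
                              (neg-antimono-≤ (proj₁ (cube y y∈P i i∈S)))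
    ... | no  _   | _     = ≤-reflexive (·-zeroˡ (λ _ → refl) y)

    facet-tight : ∀ {y} → (∀ i → i ∈ S → y i ≡ bit (x̄ i)) → ∀ i → facetRow i · y ≡ facetRhs i
    facet-tight {y} y∈fiber i with i ∈? S | x̄ i | y∈fiber i
    ... | yes i∈S | true  | yᵢ≡ = trans (·-basisˡ i y) (yᵢ≡ i∈S)
    ... | yes i∈S | false | yᵢ≡ = trans (·-⊝ˡ (basis i) y) (cong -_ (trans (·-basisˡ i y) (yᵢ≡ i∈S)))
    ... | no  _   | _     | _   = ·-zeroˡ (λ _ → refl) y

    facet-tight⁻ : ∀ {y} i → facetRow i · y ≡ facetRhs i → i ∈ S → y i ≡ bit (x̄ i)
    facet-tight⁻ {y} i tight i∈S with i ∈? S | x̄ i | tight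
    ... | yes _ | true  | tight′ = trans (sym (·-basisˡ i y)) tight′
    ... | yes _ | false | tight′ =
      neg-injective (trans (cong -_ (sym (·-basisˡ i y))) (trans (sym (·-⊝ˡ (basis i) y)) tight′))
    ... | no  i∉S | _   | _      = contradiction i∈S i∉S

    -- given the cube constraint, reversing the facets cuts out the fiber
    fiberPolyhedron : Polyhedron n
    fiberPolyhedron = record { m = m ℕ.+ n ; A = A ++ (⊝_ ∘ facetRow) ; b = b ++ (-_ ∘ facetRhs) }

    fiber≐ : Fiber P S x̄ ≐ ⟦ fiberPolyhedron ⟧
    fiber≐ y = to , from
      where
      R : Point n → ℚ → Set
      R a β = a · y ≤ β
      to : Fiber P S x̄ y → y ∈P fiberPolyhedron
      to (y∈P , y∈fiber) = Pointwise.++⁺ R y∈P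
        (λ i → ≤-reflexive (trans (·-⊝ˡ (facetRow i) y) (cong -_ (facet-tight y∈fiber i))))
      from : y ∈P fiberPolyhedron → Fiber P S x̄ y
      from y∈FP = y∈P , λ i → facet-tight⁻ i (≤-antisym (facet-valid y∈P i)
        (neg-cancel-≤ (subst (_≤ - facetRhs i) (·-⊝ˡ (facetRow i) y) (Pointwise.++⁻ʳ R A b y∈FP i))))
        where
        y∈P = Pointwise.++⁻ˡ R A b y∈FP

  module _ (T : Subset n) where

    a⇒c : conv (⟦ P ⟧ ∩ 𝓜 S) ≐ conv (⟦ P ⟧ ∩ 𝓜 (S ∪ T)) → ∀ x̄ → TIntegral T (Fiber P S x̄)
    a⇒c hulls≐ x̄ = ⊆conv⇒TIntegral (fiberPolyhedron x̄) (fiber≐ x̄) λ x (x∈P , x∈fiber) →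
      conv-mono sub (conv-face {X = ⟦ P ⟧ ∩ 𝓜 (S ∪ T)} (facetRow x̄) (facetRhs x̄)
        (λ i y (y∈P , _) → facet-valid x̄ y∈P i) (facet-tight x̄ x∈fiber)
        (proj₁ (hulls≐ x) (conv-point _ (x∈P , fiber⊆𝓜 x̄ x∈fiber))))
      where
      sub : ∀ y → (⟦ P ⟧ ∩ 𝓜 (S ∪ T)) y × (∀ i → facetRow x̄ i · y ≡ facetRhs x̄ i) →
        (Fiber P S x̄ ∩ 𝓜 T) y
      sub y ((y∈P , y∈𝓜) , tight) =
        (y∈P , λ i → facet-tight⁻ x̄ i (tight i)) , λ i i∈T → y∈𝓜 i (q⊆p∪q S T i∈T)

    c⇒a : (∀ x̄ → TIntegral T (Fiber P S x̄)) → conv (⟦ P ⟧ ∩ 𝓜 S) ≐ conv (⟦ P ⟧ ∩ 𝓜 (S ∪ T))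
    c⇒a fibers-int x =
      conv-flatten (⟦ P ⟧ ∩ 𝓜 (S ∪ T)) ∘ conv-mono each ,
      conv-mono {X = ⟦ P ⟧ ∩ 𝓜 (S ∪ T)} (λ y (y∈P , y∈𝓜) → y∈P , λ i i∈S → y∈𝓜 i (p⊆p∪q T i∈S))
      where
      each : ∀ y → (⟦ P ⟧ ∩ 𝓜 S) y → conv (⟦ P ⟧ ∩ 𝓜 (S ∪ T)) y
      each y (y∈P , y∈𝓜) = conv-mono sub (proj₁ (fibers-int x̄ y) (y∈P , y∈fiber))
        where
        x̄ : Fin n → Bool
        x̄ i = does (y i ≟ 1ℚ)
        y∈fiber : ∀ i → i ∈ S → y i ≡ bit (x̄ i)
        y∈fiber i i∈S = let (0≤yᵢ , yᵢ≤1) = cube y y∈P i i∈S in IsInt∩[0,1]⇒bit (y∈𝓜 i i∈S) 0≤yᵢ yᵢ≤1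
        sub : ∀ z → (Fiber P S x̄ ∩ 𝓜 T) z → (⟦ P ⟧ ∩ 𝓜 (S ∪ T)) z
        sub z ((z∈P , z∈fiber) , z∈𝓜) = z∈P , λ i i∈S∪T →
          [ fiber⊆𝓜 x̄ z∈fiber i , z∈𝓜 i ]′ (x∈p∪q⁻ S T i∈S∪T)

    b⇒c : (∀ x̄ F → IsMinimalFace (Fiber P S x̄) F → Nonempty (F ∩ 𝓜 T)) → ∀ x̄ → TIntegral T (Fiber P S x̄)
    b⇒c meets x̄ = TIntegral-resp-≐ (≐-sym (fiber≐ x̄)) (minimalFaces⇒TIntegral (fiberPolyhedron x̄) T
      (λ F F-minimal → meets x̄ F (IsMinimalFace-resp-≐ (≐-sym (fiber≐ x̄)) F-minimal)))

    c⇒b : (∀ x̄ → TIntegral T (Fiber P S x̄)) → ∀ x̄ F → IsMinimalFace (Fiber P S x̄) F → Nonempty (F ∩ 𝓜 T)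
    c⇒b fibers-int x̄ F (F-face , F≢∅ , _) = TIntegral⇒face-meets-𝓜 (fibers-int x̄) F-face F≢∅

corollary5 : (n : ℕ) (S T : Subset n) (P : Polyhedron n) →
    InUnitCubeOn S P →
    let
      a = conv (⟦ P ⟧ ∩ 𝓜 S) ≐ conv (⟦ P ⟧ ∩ 𝓜 (S ∪ T))
      b = (x̄ : Fin n → Bool) → (F : PSet n) →
            IsMinimalFace (Fiber P S x̄) F → Nonempty (F ∩ 𝓜 T)
      c = (x̄ : Fin n → Bool) → TIntegral T (Fiber P S x̄)
    in ((a → b) × (b → a)) × ((b → c) × (c → b))
corollary5 n S T P cube = (c⇒b T ∘ a⇒c T , c⇒a T ∘ b⇒c T) , (b⇒c T , c⇒b T)
  where open Fibers P S cube
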